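{- Let $c_n$ be the number of $U_k$-equivalence classes of the set $\mathcal{L}_n$ of Łukasiewicz paths of length $n$. Then $\sum_{n\geq 0} c_n x^n=\frac{1-x-\sqrt{1-2x-3x^2}}{2x^2}$, the generating function of the Motzkin numbers.
   Context: A Łukasiewicz path of length $n$ is a sequence of $n$ steps from $\{(1,i): i\geq -1\}$ starting at $(0,0)$, ending at $(n,0)$ and never going below the $x$-axis. Write $D=(1,-1)$, $F=(1,0)$, $U_k=(1,k)$ for $k\geq 1$. Steps are numbered $1,\dots,n$. Two Łukasiewicz paths of the same length are $U_k$-equivalent if for every $k\geq 1$ the set of positions of the steps $U_k$ is the same in both paths. -}

module Defs where

open import Data.Nat using (ℕ; zero; suc; _+_; _*_)
open import Data.List using (List; []; _∷_; zipWith; reverse)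
open import Data.Nat.ListAction using (sum)
open import Data.Vec using (Vec; []; _∷_; lookup)
open import Data.Fin using (Fin)
open import Data.Empty using (⊥)
open import Relation.Binary.PropositionalEquality using (_≡_; refl)
open import Function.Bundles using (_⇔_)

-- D = (1,-1), F = (1,0),
-- U k = (1, k+1), i.e. the constructor  U k  encodes the step U_{k+1}
-- (so U 0 is U_1, U 1 is U_2, ...; every U_j with j ≥ 1 occurs exactly once).
data Step : Set where
  D : Step
  F : Step
  U : ℕ → Step

ValidFrom : {n : ℕ} → ℕ → Vec Step n → Set
ValidFrom h []           = h ≡ 0
ValidFrom zero    (D ∷ s) = ⊥
ValidFrom (suc h) (D ∷ s) = ValidFrom h s
ValidFrom h (F ∷ s)      = ValidFrom h s
ValidFrom h (U k ∷ s)    = ValidFrom (h + suc k) s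

IsLuk : {n : ℕ} → Vec Step n → Set
IsLuk p = ValidFrom 0 p

UkEquiv : {n : ℕ} → Vec Step n → Vec Step n → Set
UkEquiv {n} p q = (k : ℕ) (i : Fin n) → (lookup p i ≡ U k) ⇔ (lookup q i ≡ U k)

-- Motzkin numbers: coefficients of M(x) = (1 - x - sqrt(1-2x-3x^2))/(2x^2),
-- the unique power series with M = 1 + x M + x^2 M^2, i.e.
-- M_0 = 1,  M_{n+1} = M_n + Σ_{k=0}^{n-1} M_k M_{n-1-k}.
-- motzkinRev n = [M_n, M_{n-1}, ..., M_0].
private
  nextM : List ℕ → List ℕ
  nextM []      = []
  nextM (m ∷ t) = (m + sum (zipWith _*_ t (reverse t))) ∷ m ∷ t

motzkinRev : ℕ → List ℕ
motzkinRev zero    = 1 ∷ []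
motzkinRev (suc n) = nextM (motzkinRev n)

motzkin : ℕ → ℕ
motzkin n with motzkinRev n
... | []    = 0
... | m ∷ _ = m

private
  _ : motzkin 0 ≡ 1
  _ = refl
  _ : motzkin 4 ≡ 9
  _ = refl
  _ : motzkin 6 ≡ 51
  _ = refl

module Submission where

-- Two paths are U_k-equivalent iff they have the same mark word, in which D and F are
-- merged into one letter and every U_k is kept; so c_n counts the mark words of
-- Łukasiewicz paths of length n.  A word is one iff the greedy path (a D whenever the
-- height is positive, an F otherwise) ends at height 0.  Such feasible words decompose
-- uniquely as the empty word, (plain) w, or U_{h+1} x (plain) y, where x with every
-- plain letter read as D descends exactly from height h to 0 and x, y are feasible.
-- Hence they are in bijection with Motzkin trees, where a binary node has size 2, and
-- these are enumerated by a table that grows exactly like the recursion defining M_n.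

open import Defs
open import Data.Nat using (ℕ; zero; suc; pred; _+_; _*_; _∸_; _≤_; _<_; z≤n; s≤s)
open import Data.Nat.Properties
open import Data.Nat.ListAction using (sum)
open import Data.Nat.Induction using (<-wellFounded; <-rec)
open import Data.Vec using (Vec; []; _∷_; lookup)
open import Data.Fin using (zero; suc)
open import Data.List
  using (List; []; _∷_; _++_; length; map; concat; concatMap; zipWith; reverse;
         cartesianProductWith; downFrom; upTo; applyUpTo)
open import Data.List.Properties
  using (∷-injectiveˡ; ∷-injectiveʳ; length-++; length-++-≤ˡ; length-++-≤ʳ; length-map;
         map-∘; map-id-local; map-zipWith; zipWith-map; zipWith-cong; reverse-map; reverse-downFrom)
open import Data.List.NonEmpty as List⁺ using (List⁺; [_]; _∷_)
open import Data.List.Membership.Propositional using (_∈_)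
open import Data.List.Membership.Propositional.Properties
  using (∈-map⁺; ∈-map⁻; ∈-++⁺ˡ; ∈-++⁺ʳ; ∈-++⁻; ∈-concat⁺′; ∈-concat⁻′;
         ∈-cartesianProductWith⁺; ∈-cartesianProductWith⁻)
open import Data.List.Relation.Unary.All as All using (All; []; _∷_)
import Data.List.Relation.Unary.All.Properties as All
open import Data.List.Relation.Unary.AllPairs as AllPairs using (AllPairs; []; _∷_)
import Data.List.Relation.Unary.AllPairs.Properties as AllPairs
open import Data.List.Relation.Unary.Any as Any using (Any; here; there)
open import Data.List.Relation.Unary.Unique.Propositional using (Unique)
import Data.List.Relation.Unary.Unique.Propositional.Properties as Unique
open import Data.List.Relation.Binary.Disjoint.Propositional using (Disjoint)
open import Data.Product using (Σ; ∃; ∃₂; _×_; _,_; proj₁; proj₂; map₂)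
open import Data.Sum using (inj₁; inj₂)
open import Function.Base using (id; _∘_; _on_)
open import Function.Bundles using (_⇔_; mk⇔; Equivalence)
open import Induction.WellFounded using (Acc; acc)
open import Relation.Binary.Construct.On using (wellFounded)
open import Relation.Binary.PropositionalEquality
  using (_≡_; _≢_; refl; sym; trans; cong; cong₂; subst; module ≡-Reasoning)
open import Relation.Nullary using (¬_)

length-concat : ∀ {A : Set} (xss : List (List A)) → length (concat xss) ≡ sum (map length xss)
length-concat []         = refl
length-concat (xs ∷ xss) = trans (length-++ xs) (cong (length xs +_) (length-concat xss))

length-cartesianProductWith : ∀ {A B C : Set} (f : A → B → C) xs ys →
                              length (cartesianProductWith f xs ys) ≡ length xs * length ys
length-cartesianProductWith f []       ys = refl
length-cartesianProductWith f (x ∷ xs) ys = begin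
  length (map (f x) ys ++ cartesianProductWith f xs ys)
    ≡⟨ length-++ (map (f x) ys) ⟩
  length (map (f x) ys) + length (cartesianProductWith f xs ys)
    ≡⟨ cong₂ _+_ (length-map (f x) ys) (length-cartesianProductWith f xs ys) ⟩
  length ys + length xs * length ys ∎
  where open ≡-Reasoning

antidiagonal : ℕ → List (ℕ × ℕ)
antidiagonal zero    = (0 , 0) ∷ []
antidiagonal (suc m) = (suc m , 0) ∷ map (map₂ suc) (antidiagonal m)

∈-antidiagonal⁺ : ∀ i j → (i , j) ∈ antidiagonal (i + j)
∈-antidiagonal⁺ zero    zero    = here refl
∈-antidiagonal⁺ (suc i) zero    rewrite +-identityʳ i = here refl
∈-antidiagonal⁺ i       (suc j) rewrite +-suc i j = there (∈-map⁺ (map₂ suc) (∈-antidiagonal⁺ i j))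

∈-antidiagonal⁻ : ∀ {m i j} → (i , j) ∈ antidiagonal m → i + j ≡ m
∈-antidiagonal⁻ {zero}  (here refl) = refl
∈-antidiagonal⁻ {suc m} (here refl) = +-identityʳ (suc m)
∈-antidiagonal⁻ {suc m} (there ij∈) with (i , j) , ij∈′ , refl ← ∈-map⁻ (map₂ suc) ij∈ =
  trans (+-suc i j) (cong suc (∈-antidiagonal⁻ ij∈′))

antidiagonal-bounds : ∀ {m i j} → (i , j) ∈ antidiagonal m → i ≤ m × j ≤ m
antidiagonal-bounds {i = i} {j} ij∈ =
  subst (i ≤_) i+j≡m (m≤m+n i j) , subst (j ≤_) i+j≡m (m≤n+m j i)
  where i+j≡m = ∈-antidiagonal⁻ ij∈

antidiagonal-proj₂-distinct : ∀ m → AllPairs (_≢_ on proj₂) (antidiagonal m)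
antidiagonal-proj₂-distinct zero    = [] ∷ []
antidiagonal-proj₂-distinct (suc m) =
  All.map⁺ (All.universal (λ _ ()) (antidiagonal m))
  ∷ AllPairs.map⁺ (AllPairs.map (_∘ suc-injective) (antidiagonal-proj₂-distinct m))

zipWith-downFrom-applyUpTo : ∀ {A : Set} (h : ℕ → ℕ → A) g m →
  zipWith h (downFrom (suc m)) (applyUpTo g (suc m)) ≡ map (λ (i , j) → h i (g j)) (antidiagonal m)
zipWith-downFrom-applyUpTo h g zero    = refl
zipWith-downFrom-applyUpTo h g (suc m) = cong (h (suc m) (g 0) ∷_) (begin
  zipWith h (downFrom (suc m)) (applyUpTo (g ∘ suc) (suc m))
    ≡⟨ zipWith-downFrom-applyUpTo h (g ∘ suc) m ⟩
  map (λ (i , j) → h i (g (suc j))) (antidiagonal m)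
    ≡⟨ map-∘ (antidiagonal m) ⟩
  map (λ (i , j) → h i (g j)) (map (map₂ suc) (antidiagonal m)) ∎)
  where open ≡-Reasoning

record Enumerates {A : Set} (P : A → Set) (xs : List A) : Set where
  field
    unique   : Unique xs
    sound    : ∀ {x} → x ∈ xs → P x
    complete : ∀ {x} → P x → x ∈ xs

map-enumerates : ∀ {A B : Set} {P : A → Set} {Q : B → Set} {f : A → B} {xs} →
                 (∀ {x y} → f x ≡ f y → x ≡ y) →
                 (∀ {x} → P x → Q (f x)) →
                 (∀ {y} → Q y → ∃ λ x → P x × f x ≡ y) →
                 Enumerates P xs → Enumerates Q (map f xs)
map-enumerates {Q = Q} {f} f-injective f-preserves f-onto e = record
  { unique   = Unique.map⁺ f-injective unique
  ; sound    = λ y∈ → let _ , x∈ , y≡fx = ∈-map⁻ f y∈ in subst Q (sym y≡fx) (f-preserves (sound x∈))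
  ; complete = λ q → let _ , p , fx≡y = f-onto q in subst (_∈ _) fx≡y (∈-map⁺ f (complete p))
  }
  where open Enumerates e

-- Mark words and U_k-equivalence

data Mark : Set where
  plain : Mark
  up    : ℕ → Mark

up-injective : ∀ {j k} → up j ≡ up k → j ≡ k
up-injective refl = refl

mark : Step → Mark
mark D     = plain
mark F     = plain
mark (U k) = up k

marks : ∀ {n} → Vec Step n → List Mark
marks []      = []
marks (s ∷ p) = mark s ∷ marks p

length-marks : ∀ {n} (p : Vec Step n) → length (marks p) ≡ n
length-marks []      = refl
length-marks (_ ∷ p) = cong suc (length-marks p)

U⇔⇒mark≡ : ∀ {a b} → (∀ k → (a ≡ U k) ⇔ (b ≡ U k)) → mark a ≡ mark b
U⇔⇒mark≡ {U k} e with refl ← Equivalence.to (e k) refl = refl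
U⇔⇒mark≡ {b = U k} e with refl ← Equivalence.from (e k) refl = refl
U⇔⇒mark≡ {D} {D} _ = refl
U⇔⇒mark≡ {D} {F} _ = refl
U⇔⇒mark≡ {F} {D} _ = refl
U⇔⇒mark≡ {F} {F} _ = refl

up≡mark⇒U : ∀ {b k} → up k ≡ mark b → b ≡ U k
up≡mark⇒U {U _} refl = refl

UkEquiv⇒marks≡ : ∀ {n} {p q : Vec Step n} → UkEquiv p q → marks p ≡ marks q
UkEquiv⇒marks≡ {p = []}    {[]}    _ = refl
UkEquiv⇒marks≡ {p = _ ∷ _} {_ ∷ _} e =
  cong₂ _∷_ (U⇔⇒mark≡ (λ k → e k zero)) (UkEquiv⇒marks≡ (λ k i → e k (suc i)))

marks≡⇒mark-lookup≡ : ∀ {n} {p q : Vec Step n} → marks p ≡ marks q →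
                      ∀ i → mark (lookup p i) ≡ mark (lookup q i)
marks≡⇒mark-lookup≡ {p = _ ∷ _} {_ ∷ _} eq zero    = ∷-injectiveˡ eq
marks≡⇒mark-lookup≡ {p = _ ∷ _} {_ ∷ _} eq (suc i) = marks≡⇒mark-lookup≡ (∷-injectiveʳ eq) i

marks≡⇒UkEquiv : ∀ {n} {p q : Vec Step n} → marks p ≡ marks q → UkEquiv p q
marks≡⇒UkEquiv eq k i = mk⇔ (transport eq) (transport (sym eq))
  where
  transport : ∀ {p q} → marks p ≡ marks q → lookup p i ≡ U k → lookup q i ≡ U k
  transport eq pᵢ≡Uk = up≡mark⇒U (trans (cong mark (sym pᵢ≡Uk)) (marks≡⇒mark-lookup≡ eq i))

-- The greedy path: a plain letter is a D when the height is positive, an F otherwise.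
Feasible : ℕ → List Mark → Set
Feasible h []          = h ≡ 0
Feasible h (plain ∷ w) = Feasible (pred h) w
Feasible h (up k ∷ w)  = Feasible (h + suc k) w

Feasible-antitone : ∀ {h h′} w → h′ ≤ h → Feasible h w → Feasible h′ w
Feasible-antitone []          h′≤h refl = n≤0⇒n≡0 h′≤h
Feasible-antitone (plain ∷ w) h′≤h f    = Feasible-antitone w (pred-mono-≤ h′≤h) f
Feasible-antitone (up k ∷ w)  h′≤h f    = Feasible-antitone w (+-monoˡ-≤ (suc k) h′≤h) f

valid⇒feasible : ∀ {n} h (p : Vec Step n) → ValidFrom h p → Feasible h (marks p)
valid⇒feasible zero    []        v = v
valid⇒feasible (suc h) (D ∷ p)   v = valid⇒feasible h p v
valid⇒feasible zero    (F ∷ p)   v = valid⇒feasible zero p v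
valid⇒feasible (suc h) (F ∷ p)   v = Feasible-antitone (marks p) (n≤1+n h) (valid⇒feasible (suc h) p v)
valid⇒feasible zero    (U k ∷ p) v = valid⇒feasible (suc k) p v
valid⇒feasible (suc h) (U k ∷ p) v = valid⇒feasible (suc h + suc k) p v

-- Pads with F steps when w is shorter than n; only meaningful when length w ≡ n.
realize : (n : ℕ) → ℕ → List Mark → Vec Step n
realize zero    h       w           = []
realize (suc n) h       []          = F ∷ realize n h []
realize (suc n) h       (up k ∷ w)  = U k ∷ realize n (h + suc k) w
realize (suc n) zero    (plain ∷ w) = F ∷ realize n zero w
realize (suc n) (suc h) (plain ∷ w) = D ∷ realize n h w

realize-valid : ∀ n h w → length w ≡ n → Feasible h w → ValidFrom h (realize n h w)
realize-valid zero    zero    []          _ f = f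
realize-valid (suc n) zero    (up k ∷ w)  l f = realize-valid n (suc k) w (suc-injective l) f
realize-valid (suc n) (suc h) (up k ∷ w)  l f = realize-valid n (suc h + suc k) w (suc-injective l) f
realize-valid (suc n) zero    (plain ∷ w) l f = realize-valid n zero w (suc-injective l) f
realize-valid (suc n) (suc h) (plain ∷ w) l f = realize-valid n h w (suc-injective l) f

marks-realize : ∀ n h w → length w ≡ n → marks (realize n h w) ≡ w
marks-realize zero    h       []          _ = refl
marks-realize (suc n) h       (up k ∷ w)  l = cong (up k ∷_) (marks-realize n (h + suc k) w (suc-injective l))
marks-realize (suc n) zero    (plain ∷ w) l = cong (plain ∷_) (marks-realize n zero w (suc-injective l))
marks-realize (suc n) (suc h) (plain ∷ w) l = cong (plain ∷_) (marks-realize n h w (suc-injective l))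

-- Exact descents and the decomposition of feasible words

-- Every plain letter is read as a D.
Exact : ℕ → List Mark → Set
Exact h []          = h ≡ 0
Exact h (plain ∷ w) = 0 < h × Exact (pred h) w
Exact h (up k ∷ w)  = Exact (h + suc k) w

exactHeight : List Mark → ℕ
exactHeight []          = 0
exactHeight (plain ∷ w) = suc (exactHeight w)
exactHeight (up k ∷ w)  = exactHeight w ∸ suc k

exact⇒feasible : ∀ {h h′} w → h′ ≤ h → Exact h w → Feasible h′ w
exact⇒feasible     []          h′≤h refl    = n≤0⇒n≡0 h′≤h
exact⇒feasible     (plain ∷ w) h′≤h (_ , e) = exact⇒feasible w (pred-mono-≤ h′≤h) e
exact⇒feasible {h} (up k ∷ w)  h′≤h e       = exact⇒feasible {h + suc k} w (+-monoˡ-≤ (suc k) h′≤h) e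

exact⇒exactHeight : ∀ {h} w → Exact h w → exactHeight w ≡ h
exact⇒exactHeight     []          refl        = refl
exact⇒exactHeight     (plain ∷ w) (s≤s _ , e) = cong suc (exact⇒exactHeight w e)
exact⇒exactHeight {h} (up k ∷ w)  e           =
  trans (cong (_∸ suc k) (exact⇒exactHeight w e)) (m+n∸n≡m h (suc k))

feasible⇒exact : ∀ {h} w → Feasible h w → Exact (exactHeight w) w × h ≤ exactHeight w
feasible⇒exact         []          refl = refl , z≤n
feasible⇒exact {zero}  (plain ∷ w) f with e , _   ← feasible⇒exact w f = (s≤s z≤n , e) , z≤n
feasible⇒exact {suc h} (plain ∷ w) f with e , h≤m ← feasible⇒exact w f = (s≤s z≤n , e) , s≤s h≤m
feasible⇒exact {h}     (up k ∷ w)  f with e , h+k<m ← feasible⇒exact w f =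
  subst (λ m → Exact m w) (sym (m∸n+n≡m k<m)) e , m+n≤o⇒m≤o∸n h h+k<m
  where
  k<m : suc k ≤ exactHeight w
  k<m = ≤-trans (m≤n+m (suc k) h) h+k<m

exact-++-feasible : ∀ {h} x {y} → Exact h x → Feasible 0 y → Feasible (suc h) (x ++ plain ∷ y)
exact-++-feasible []          refl        f = f
exact-++-feasible (plain ∷ x) (s≤s _ , e) f = exact-++-feasible x e f
exact-++-feasible (up k ∷ x)  e           f = exact-++-feasible x e f

split-feasible : ∀ h w → Feasible (suc h) w →
                 ∃₂ λ x y → w ≡ x ++ plain ∷ y × Exact h x × Feasible 0 y
split-feasible zero    (plain ∷ w) f = [] , w , refl , refl , f
split-feasible (suc h) (plain ∷ w) f with x , y , refl , e , f′ ← split-feasible h w f =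
  plain ∷ x , y , refl , (s≤s z≤n , e) , f′
split-feasible h       (up k ∷ w)  f with x , y , refl , e , f′ ← split-feasible (h + suc k) w f =
  up k ∷ x , y , refl , e , f′

exact-++-injective : ∀ {h} x x′ {y y′} → Exact h x → Exact h x′ →
                     x ++ plain ∷ y ≡ x′ ++ plain ∷ y′ → x ≡ x′ × y ≡ y′
exact-++-injective []          []           _        _        eq   = refl , ∷-injectiveʳ eq
exact-++-injective []          (plain ∷ x′) refl     (() , _) refl
exact-++-injective (plain ∷ x) []           (() , _) refl     refl
exact-++-injective (plain ∷ x) (plain ∷ x′) (_ , e)  (_ , e′) eq
  with refl , refl ← exact-++-injective x x′ e e′ (∷-injectiveʳ eq) = refl , refl
exact-++-injective (up k ∷ x)  (up k′ ∷ x′) e        e′       eq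
  with refl ← ∷-injectiveˡ eq
  with refl , refl ← exact-++-injective x x′ e e′ (∷-injectiveʳ eq) = refl , refl

-- Motzkin trees

data Tree : Set where
  leaf   : Tree
  unary  : Tree → Tree
  binary : Tree → Tree → Tree

unary-injective : ∀ {s t} → unary s ≡ unary t → s ≡ t
unary-injective refl = refl

binary-injective : ∀ {s s′ t t′} → binary s s′ ≡ binary t t′ → s ≡ t × s′ ≡ t′
binary-injective refl = refl , refl

size : Tree → ℕ
size leaf         = 0
size (unary t)    = suc (size t)
size (binary s t) = suc (suc (size s + size t))

-- The letter up k lifts the path to height k + 1; then decode s descends exactly to 1
-- and the plain letter is a D back to 0.
decode : Tree → List Mark
decode leaf         = []
decode (unary t)    = plain ∷ decode t
decode (binary s t) = up (exactHeight (decode s)) ∷ decode s ++ plain ∷ decode t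

length-decode : ∀ t → length (decode t) ≡ size t
length-decode leaf         = refl
length-decode (unary t)    = cong suc (length-decode t)
length-decode (binary s t) = cong suc (begin
  length (decode s ++ plain ∷ decode t)       ≡⟨ length-++ (decode s) ⟩
  length (decode s) + suc (length (decode t)) ≡⟨ +-suc _ _ ⟩
  suc (length (decode s) + length (decode t)) ≡⟨ cong₂ (λ a b → suc (a + b)) (length-decode s) (length-decode t) ⟩
  suc (size s + size t)                       ∎)
  where open ≡-Reasoning

decode-feasible : ∀ t → Feasible 0 (decode t)
decode-exact    : ∀ t → Exact (exactHeight (decode t)) (decode t)

decode-feasible leaf         = refl
decode-feasible (unary t)    = decode-feasible t
decode-feasible (binary s t) = exact-++-feasible (decode s) (decode-exact s) (decode-feasible t)

decode-exact t = proj₁ (feasible⇒exact (decode t) (decode-feasible t))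

decode-injective : ∀ {s t} → decode s ≡ decode t → s ≡ t
decode-injective {leaf}        {leaf}        _  = refl
decode-injective {unary s}     {unary t}     eq = cong unary (decode-injective (∷-injectiveʳ eq))
decode-injective {binary s s′} {binary t t′} eq
  with height≡ ← up-injective (∷-injectiveˡ eq)
  with s≡t , s′≡t′ ← exact-++-injective (decode s) (decode t)
                       (subst (λ h → Exact h (decode s)) height≡ (decode-exact s)) (decode-exact t)
                       (∷-injectiveʳ eq)
  = cong₂ binary (decode-injective s≡t) (decode-injective s′≡t′)

decode-surjective : ∀ w → Feasible 0 w → ∃ λ t → decode t ≡ w
decode-surjective w = go w (wellFounded length <-wellFounded w)
  where
  go : ∀ w → Acc (_<_ on length) w → Feasible 0 w → ∃ λ t → decode t ≡ w
  go []          _         _ = leaf , refl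
  go (plain ∷ w) (acc rec) f with t , refl ← go w (rec {w} ≤-refl) f = unary t , refl
  go (up k ∷ w)  (acc rec) f
    with x , y , refl , e , f′ ← split-feasible k w f
    with refl ← exact⇒exactHeight x e
    with s , refl ← go x (rec {x} (s≤s (length-++-≤ˡ x))) (exact⇒feasible x z≤n e)
       | t , refl ← go y (rec {y} (m≤n⇒m≤1+n (length-++-≤ʳ (plain ∷ y) {x}))) f′
    = binary s t , refl

-- Enumerating Motzkin trees by size

convolve : List (List Tree) → List Tree
convolve tss = concat (zipWith (cartesianProductWith binary) tss (reverse tss))

grow : List⁺ (List Tree) → List⁺ (List Tree)
grow tss = (map unary (List⁺.head tss) ++ convolve (List⁺.tail tss)) ∷ List⁺.toList tss

-- table n = trees n ∷ … ∷ trees 0 grows exactly like motzkinRev n = M_n ∷ … ∷ M_0.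
table : ℕ → List⁺ (List Tree)
table zero    = [ leaf ∷ [] ]
table (suc n) = grow (table n)

trees : ℕ → List Tree
trees n = List⁺.head (table n)

block : ℕ × ℕ → List Tree
block (i , j) = cartesianProductWith binary (trees i) (trees j)

binaries : ℕ → List Tree
binaries m = concatMap block (antidiagonal m)

table≡map-trees : ∀ m → List⁺.toList (table m) ≡ map trees (downFrom (suc m))
table≡map-trees zero    = refl
table≡map-trees (suc m) = cong (trees (suc m) ∷_) (table≡map-trees m)

trees-suc-suc : ∀ m → trees (suc (suc m)) ≡ map unary (trees (suc m)) ++ binaries m
trees-suc-suc m = cong (map unary (trees (suc m)) ++_) (begin
  convolve (List⁺.toList (table m))
    ≡⟨ cong convolve (table≡map-trees m) ⟩
  concat (zipWith (cartesianProductWith binary) (map trees ds) (reverse (map trees ds)))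
    ≡⟨ cong (λ r → concat (zipWith (cartesianProductWith binary) (map trees ds) r))
            (trans (sym (reverse-map trees ds)) (cong (map trees) (reverse-downFrom (suc m)))) ⟩
  concat (zipWith (cartesianProductWith binary) (map trees ds) (map trees (upTo (suc m))))
    ≡⟨ cong concat (zipWith-map (cartesianProductWith binary) trees trees ds (upTo (suc m))) ⟩
  concat (zipWith (λ i j → block (i , j)) ds (upTo (suc m)))
    ≡⟨ cong concat (zipWith-downFrom-applyUpTo (λ i j → block (i , j)) id m) ⟩
  binaries m ∎)
  where
  open ≡-Reasoning
  ds = downFrom (suc m)

∈-binaries⁺ : ∀ {m i j s s′} → (i , j) ∈ antidiagonal m → s ∈ trees i → s′ ∈ trees j →
              binary s s′ ∈ binaries m
∈-binaries⁺ ij∈ s∈ s′∈ = ∈-concat⁺′ (∈-cartesianProductWith⁺ binary s∈ s′∈) (∈-map⁺ block ij∈)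

∈-binaries⁻ : ∀ {m v} → v ∈ binaries m →
              ∃₂ λ i j → (i , j) ∈ antidiagonal m ×
              ∃₂ λ s s′ → s ∈ trees i × s′ ∈ trees j × v ≡ binary s s′
∈-binaries⁻ {m} v∈
  with _ , v∈block , block∈ ← ∈-concat⁻′ (map block (antidiagonal m)) v∈
  with (i , j) , ij∈ , refl ← ∈-map⁻ block block∈
  = i , j , ij∈ , ∈-cartesianProductWith⁻ binary (trees i) (trees j) v∈block

size-∈-trees : ∀ n {t} → t ∈ trees n → size t ≡ n
size-∈-trees = <-rec _ sound
  where
  sound : ∀ n → (∀ {i} → i < n → ∀ {t} → t ∈ trees i → size t ≡ i) → ∀ {t} → t ∈ trees n → size t ≡ n
  sound zero          _   (here refl) = refl
  sound (suc zero)    _   (here refl) = refl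
  sound (suc (suc m)) rec t∈ with ∈-++⁻ (map unary (trees (suc m))) (subst (_ ∈_) (trees-suc-suc m) t∈)
  ... | inj₁ t∈unaries with _ , s∈ , refl ← ∈-map⁻ unary t∈unaries = cong suc (rec ≤-refl s∈)
  ... | inj₂ t∈binaries with i , j , ij∈ , s , s′ , s∈ , s′∈ , refl ← ∈-binaries⁻ {m} t∈binaries =
    cong (2 +_) (trans (cong₂ _+_ (rec (below i≤m) s∈) (rec (below j≤m) s′∈)) (∈-antidiagonal⁻ ij∈))
    where
    i≤m = proj₁ (antidiagonal-bounds ij∈)
    j≤m = proj₂ (antidiagonal-bounds ij∈)
    below : ∀ {k} → k ≤ m → k < suc (suc m)
    below k≤m = s≤s (m≤n⇒m≤1+n k≤m)

∈-trees-size : ∀ t → t ∈ trees (size t)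
∈-trees-size leaf          = here refl
∈-trees-size (unary t)     = ∈-++⁺ˡ (∈-map⁺ unary (∈-trees-size t))
∈-trees-size (binary s s′) = subst (binary s s′ ∈_) (sym (trees-suc-suc (size s + size s′)))
  (∈-++⁺ʳ _ (∈-binaries⁺ (∈-antidiagonal⁺ (size s) (size s′)) (∈-trees-size s) (∈-trees-size s′)))

blocks-disjoint : ∀ {p q} → proj₂ p ≢ proj₂ q → Disjoint (block p) (block q)
blocks-disjoint {i , j} {i′ , j′} j≢j′ (v∈p , v∈q)
  with _ , s′ , _ , s′∈ , refl ← ∈-cartesianProductWith⁻ binary (trees i) (trees j) v∈p
  with _ , t′ , _ , t′∈ , eq   ← ∈-cartesianProductWith⁻ binary (trees i′) (trees j′) v∈q
  = j≢j′ (begin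
    j       ≡⟨ size-∈-trees j s′∈ ⟨
    size s′ ≡⟨ cong size (proj₂ (binary-injective eq)) ⟩
    size t′ ≡⟨ size-∈-trees j′ t′∈ ⟩
    j′      ∎)
  where open ≡-Reasoning

binaries-unique : ∀ m → (∀ {i} → i ≤ m → Unique (trees i)) → Unique (binaries m)
binaries-unique m unique = Unique.concat⁺
  (All.map⁺ (All.tabulate λ {ij} ij∈ → Unique.cartesianProductWith⁺ binary binary-injective
    (unique (proj₁ (antidiagonal-bounds ij∈))) (unique (proj₂ (antidiagonal-bounds ij∈)))))
  (AllPairs.map⁺ (AllPairs.map (λ {p} {q} → blocks-disjoint {p} {q}) (antidiagonal-proj₂-distinct m)))

unaries-binaries-disjoint : ∀ ts m → Disjoint (map unary ts) (binaries m)
unaries-binaries-disjoint ts m (v∈unaries , v∈binaries)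
  with _ , _ , refl ← ∈-map⁻ unary v∈unaries
  with _ , _ , _ , _ , _ , _ , _ , () ← ∈-binaries⁻ {m} v∈binaries

trees-unique : ∀ n → Unique (trees n)
trees-unique = <-rec _ unique
  where
  unique : ∀ n → (∀ {i} → i < n → Unique (trees i)) → Unique (trees n)
  unique zero          _   = [] ∷ []
  unique (suc zero)    _   = [] ∷ []
  unique (suc (suc m)) rec = subst Unique (sym (trees-suc-suc m)) (Unique.++⁺
    (Unique.map⁺ unary-injective (rec ≤-refl))
    (binaries-unique m (λ i≤m → rec (s≤s (m≤n⇒m≤1+n i≤m))))
    (unaries-binaries-disjoint (trees (suc m)) m))

trees-enumerate : ∀ n → Enumerates (λ t → size t ≡ n) (trees n)
trees-enumerate n = record
  { unique   = trees-unique n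
  ; sound    = size-∈-trees n
  ; complete = λ { refl → ∈-trees-size _ }
  }

length-convolve : ∀ tss → length (convolve tss) ≡ sum (zipWith _*_ (map length tss) (reverse (map length tss)))
length-convolve tss = begin
  length (concat (zipWith (cartesianProductWith binary) tss (reverse tss)))
    ≡⟨ length-concat (zipWith (cartesianProductWith binary) tss (reverse tss)) ⟩
  sum (map length (zipWith (cartesianProductWith binary) tss (reverse tss)))
    ≡⟨ cong sum (map-zipWith (cartesianProductWith binary) length tss (reverse tss)) ⟩
  sum (zipWith (λ xs ys → length (cartesianProductWith binary xs ys)) tss (reverse tss))
    ≡⟨ cong sum (zipWith-cong (length-cartesianProductWith binary) tss (reverse tss)) ⟩
  sum (zipWith (λ xs ys → length xs * length ys) tss (reverse tss))
    ≡⟨ cong sum (zipWith-map _*_ length length tss (reverse tss)) ⟨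
  sum (zipWith _*_ (map length tss) (map length (reverse tss)))
    ≡⟨ cong (λ ns → sum (zipWith _*_ (map length tss) ns)) (reverse-map length tss) ⟩
  sum (zipWith _*_ (map length tss) (reverse (map length tss))) ∎
  where open ≡-Reasoning

motzkinRev≡lengths : ∀ n → motzkinRev n ≡ map length (List⁺.toList (table n))
motzkinRev≡lengths zero    = refl
motzkinRev≡lengths (suc n) rewrite motzkinRev≡lengths n =
  cong (_∷ map length (List⁺.toList (table n))) (begin
    length (trees n) + sum (zipWith _*_ (map length tss) (reverse (map length tss)))
      ≡⟨ cong₂ _+_ (length-map unary (trees n)) (length-convolve tss) ⟨
    length (map unary (trees n)) + length (convolve tss)
      ≡⟨ length-++ (map unary (trees n)) ⟨
    length (map unary (trees n) ++ convolve tss) ∎)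
  where
  open ≡-Reasoning
  tss = List⁺.tail (table n)

length-trees : ∀ n → length (trees n) ≡ motzkin n
length-trees n rewrite motzkinRev≡lengths n = refl

IsPattern : ℕ → List Mark → Set
IsPattern n w = Feasible 0 w × length w ≡ n

patterns : ℕ → List (List Mark)
patterns n = map decode (trees n)

patterns-enumerate : ∀ n → Enumerates (IsPattern n) (patterns n)
patterns-enumerate n = map-enumerates decode-injective
  (λ { {t} refl → decode-feasible t , length-decode t })
  (λ { {w} (f , refl) → let t , decode-t≡w = decode-surjective w f in
       t , trans (sym (length-decode t)) (cong length decode-t≡w) , decode-t≡w })
  (trees-enumerate n)

module Representatives {n ws} (e : Enumerates (IsPattern n) ws) where
  open Enumerates e

  representatives : List (Vec Step n)
  representatives = map (realize n 0) ws

  representatives-valid : All IsLuk representatives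
  representatives-valid = All.map⁺ (All.tabulate λ w∈ →
    let f , l = sound w∈ in realize-valid n 0 _ l f)

  marks-representatives : map marks representatives ≡ ws
  marks-representatives = trans (sym (map-∘ ws))
    (map-id-local (All.tabulate λ w∈ → marks-realize n 0 _ (proj₂ (sound w∈))))

  representatives-inequivalent : AllPairs (λ p q → ¬ UkEquiv p q) representatives
  representatives-inequivalent = AllPairs.map (λ marks≢ equiv → marks≢ (UkEquiv⇒marks≡ equiv))
    (AllPairs.map⁻ (subst Unique (sym marks-representatives) unique))

  representatives-complete : (p : Vec Step n) → IsLuk p → Any (UkEquiv p) representatives
  representatives-complete p luk =
    Any.map (λ { refl → marks≡⇒UkEquiv (sym (marks-realize n 0 (marks p) (length-marks p))) })
      (∈-map⁺ (realize n 0) (complete (valid⇒feasible 0 p luk , length-marks p)))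

theorem6 : (n : ℕ) → Σ (List (Vec Step n)) (λ R → All IsLuk R × AllPairs (λ p q → ¬ UkEquiv p q) R × ((p : Vec Step n) → IsLuk p → Any (UkEquiv p) R) × length R ≡ motzkin n)
theorem6 n =
  representatives , representatives-valid , representatives-inequivalent , representatives-complete ,
  (begin
    length (map (realize n 0) (patterns n)) ≡⟨ length-map (realize n 0) (patterns n) ⟩
    length (map decode (trees n))           ≡⟨ length-map decode (trees n) ⟩
    length (trees n)                        ≡⟨ length-trees n ⟩
    motzkin n                               ∎)
  where
  open Representatives (patterns-enumerate n)
  open ≡-Reasoning
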